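{- Let $q$ be an odd prime power and let the notation be as in the context. Let $\lambda\in\mathrm{GF}(q)\setminus\{0\}$, let $R$ be a point of $\mathcal{E}_\lambda\setminus\{U_3\}$, let $\ell$ be a line meeting $\mathcal{E}_\lambda$ exactly in $R$, and let $P=\pi\cap\ell$. If $P\in\pi_0$, then $|\ell\cap\mathcal{E}|=0$ if $\lambda$ is a non-square in $\mathrm{GF}(q)$ and $|\ell\cap\mathcal{E}|=2$ if $\lambda$ is a square in $\mathrm{GF}(q)$. If $P\in\pi_1$, then $|\ell\cap\mathcal{E}|=2$ if $\lambda$ is a non-square and $|\ell\cap\mathcal{E}|=0$ if $\lambda$ is a square.
   Context: Let $q$ be a power of an odd prime and $\mathrm{PG}(3,q)$ the projective space with homogeneous coordinates $(X_1,X_2,X_3,X_4)$. Fix a non-square $\omega\in\mathrm{GF}(q)$. For $\lambda\in\mathrm{GF}(q)$ let $\mathcal{E}_\lambda$ be the elliptic quadric $X_1^2-\omega X_2^2+\lambda X_4^2+X_3X_4=0$, and let $\mathcal{E}=\mathcal{E}_0$, with quadratic form $Q(X)=X_1^2-\omega X_2^2+X_3X_4$. Let $\pi$ be the plane $X_4=0$ and $U_3=(0,0,1,0)$. Let $\pi_0$ (resp. $\pi_1$) be the set of points $X\in\pi$ with $Q(X)$ a non-zero square (resp. a non-square) in $\mathrm{GF}(q)$. -}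

module Defs where

open import Level using (Level; _⊔_) renaming (suc to lsuc)
open import Algebra.Bundles using (CommutativeRing)
open import Data.Fin using (Fin)
open import Data.Nat using (ℕ)
open import Data.Product using (Σ; ∃; ∃₂; _×_; _,_)
open import Data.Sum using (_⊎_)
open import Relation.Nullary using (¬_)
open import Relation.Binary.Definitions using (Decidable)

-- The stdlib has no Field bundle, so a field is a commutative ring with
-- decidable equality, 1 ≠ 0 and inverses of non-zero elements.
record FiniteOddField (c ℓ : Level) : Set (lsuc (c ⊔ ℓ)) where
  field
    commRing : CommutativeRing c ℓ
  open CommutativeRing commRing public hiding (ring)
  field
    _≟_     : Decidable _≈_
    1≉0     : ¬ (1# ≈ 0#)
    inverse : ∀ x → ¬ (x ≈ 0#) → ∃ λ y → x * y ≈ 1#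
    finite  : Σ ℕ λ n → Σ (Fin n → Carrier) λ e → ∀ x → ∃ λ i → e i ≈ x
    odd     : ¬ (1# + 1# ≈ 0#)

-- Geometry of PG(3,F) with a fixed non-square w (the ω of the paper).
module PG3 {c ℓ : Level} (F : FiniteOddField c ℓ) (w : FiniteOddField.Carrier F) where
  open FiniteOddField F

  IsSquare : Carrier → Set (c ⊔ ℓ)
  IsSquare a = ∃ λ b → b * b ≈ a

  NonSquare : Carrier → Set (c ⊔ ℓ)
  NonSquare a = ¬ IsSquare a

  record V4 : Set c where
    constructor ⟨_,_,_,_⟩
    field
      x₁ x₂ x₃ x₄ : Carrier
  open V4 public

  _≋_ : V4 → V4 → Set ℓ
  X ≋ Y = (x₁ X ≈ x₁ Y) × (x₂ X ≈ x₂ Y) × (x₃ X ≈ x₃ Y) × (x₄ X ≈ x₄ Y)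

  _·_ : Carrier → V4 → V4
  a · X = ⟨ a * x₁ X , a * x₂ X , a * x₃ X , a * x₄ X ⟩

  _⊕_ : V4 → V4 → V4
  X ⊕ Y = ⟨ x₁ X + x₁ Y , x₂ X + x₂ Y , x₃ X + x₃ Y , x₄ X + x₄ Y ⟩

  𝟎 : V4
  𝟎 = ⟨ 0# , 0# , 0# , 0# ⟩

  NonZero : V4 → Set ℓ
  NonZero X = ¬ (X ≋ 𝟎)

  SamePoint : V4 → V4 → Set (c ⊔ ℓ)
  SamePoint X Y = ∃ λ a → ¬ (a ≈ 0#) × (X ≋ (a · Y))

  U₃ : V4
  U₃ = ⟨ 0# , 0# , 1# , 0# ⟩

  -- Q(X) = X₁² − ω X₂² + X₃X₄  (the quadric 𝓔 = 𝓔₀)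
  Q : V4 → Carrier
  Q X = ((x₁ X * x₁ X) - (w * (x₂ X * x₂ X))) + (x₃ X * x₄ X)

  -- the form of 𝓔_λ : X₁² − ω X₂² + λ X₄² + X₃X₄
  Qλ : Carrier → V4 → Carrier
  Qλ l X = (((x₁ X * x₁ X) - (w * (x₂ X * x₂ X))) + (l * (x₄ X * x₄ X))) + (x₃ X * x₄ X)

  -- lines of PG(3,F): spanned by two linearly independent vectors A, B
  Independent : V4 → V4 → Set (c ⊔ ℓ)
  Independent A B = ∀ a b → ((a · A) ⊕ (b · B)) ≋ 𝟎 → (a ≈ 0#) × (b ≈ 0#)

  OnLine : V4 → V4 → V4 → Set (c ⊔ ℓ)
  OnLine A B X = NonZero X × ∃₂ λ a b → X ≋ ((a · A) ⊕ (b · B))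

  Inπ : V4 → Set ℓ
  Inπ X = NonZero X × (x₄ X ≈ 0#)

  Inπ₀ : V4 → Set (c ⊔ ℓ)
  Inπ₀ X = Inπ X × ¬ (Q X ≈ 0#) × IsSquare (Q X)

  Inπ₁ : V4 → Set (c ⊔ ℓ)
  Inπ₁ X = Inπ X × NonSquare (Q X)

  MeetsE0 : V4 → V4 → Set (c ⊔ ℓ)
  MeetsE0 A B = ∀ X → OnLine A B X → ¬ (Q X ≈ 0#)

  MeetsE2 : V4 → V4 → Set (c ⊔ ℓ)
  MeetsE2 A B = ∃₂ λ X Y →
    OnLine A B X × (Q X ≈ 0#) × OnLine A B Y × (Q Y ≈ 0#) × ¬ SamePoint X Y ×
    (∀ Z → OnLine A B Z → Q Z ≈ 0# → SamePoint Z X ⊎ SamePoint Z Y)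

{-# OPTIONS --safe #-}
-- A point R of 𝓔_λ other than U₃ has X₄ ≠ 0, because X₁² − ωX₂² is anisotropic for a
-- non-square ω; so R ∉ π ∋ P and the tangent line ℓ is spanned by R and P. On aR + bP,
-- Q = a²Q(R) + ab·Polar(R,P) + b²Q(P) with Q(R) = −λr₄², r₄ = X₄(R), and tangency to 𝓔_λ
-- forces Polar(R,P) = 0. With σ = Q(P), non-zero for P ∈ π₀ ∪ π₁, the points of ℓ ∩ 𝓔 are
-- the solutions of σb² = λr₄²a² with a ≠ 0: two if λσ is a square and none otherwise. The
-- four cases follow from the multiplicativity of the square class; that two non-squares
-- multiply to a square is a count: for a non-square a the squares S and aS are disjoint
-- subsets of GF(q)* of size (q − 1)/2 each, so every non-square b lies in aS.
module Submission where

open import Level using (Level; _⊔_)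
open import Algebra.Bundles using (CommutativeRing)
import Algebra.Solver.Ring.AlmostCommutativeRing as ACR
open import Data.Empty using (⊥; ⊥-elim)
import Data.Fin as Fin
open import Data.Fin.Properties using (injective⇒≤)
open import Data.Integer as ℤ using (ℤ; +_; -[1+_]; _⊖_)
import Data.Integer.Properties as ℤ
open import Data.List using (List; _∷_; _++_; map; filter; tabulate; deduplicate; length; lookup)
open import Data.List.Properties using (length-++; length-map)
open import Data.List.Relation.Unary.All using (All; lookupₛ)
open import Data.List.Relation.Unary.All.Properties using (All¬⇒¬Any; all-filter; deduplicate⁺; ¬Any⇒All¬)
open import Data.List.Relation.Unary.AllPairs using (_∷_)
import Data.List.Relation.Unary.Any as Any
open Any using (here; there)
open import Data.List.Relation.Unary.Any.Properties using (tabulate⁺)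
open import Data.List.Membership.Setoid.Properties
  using (∈-lookup; index-injective; ∈-filter⁺; ∈-deduplicate⁺; ∈-map⁺; ∈-map⁻; ∈-++⁺ˡ; ∈-++⁺ʳ; ∈-++⁻; ∈-resp-≈)
import Data.List.Relation.Unary.Unique.Setoid.Properties as Unique
open import Data.List.Relation.Unary.Unique.DecSetoid.Properties using (deduplicate-!)
import Data.Maybe as Maybe
open import Data.Nat using (zero; suc; _≤_) renaming (_+_ to _+ℕ_)
import Data.Nat.Properties as ℕ
open import Data.Product using (∃; ∃₂; _×_; _,_; proj₁; proj₂; map₂; uncurry)
open import Data.Sum as Sum using (_⊎_; inj₁; inj₂)
open import Function using (_∘_)
open import Relation.Binary.Bundles using (Setoid; DecSetoid)
open import Relation.Binary.Consequences using (dec⇒weaklyDec)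
import Relation.Binary.Construct.On as On
open import Relation.Binary.PropositionalEquality as ≡ using (_≡_)
open import Relation.Nullary using (¬_; ¬?; yes; no; contradiction)
open import Defs

-- The ring solver needs coefficients with computable equality: integers, mapped into R.
-- The optimised multiples _×′_ make fromℤ (+ 2) reduce to 1# + 1#.
module IntegerCoefficients {c ℓ : Level} (R : CommutativeRing c ℓ) where
  open CommutativeRing R
  open import Algebra.Properties.Ring ring using (-‿involutive; -0#≈0#; -‿distribˡ-*)
  open import Algebra.Properties.AbelianGroup +-abelianGroup using (⁻¹-∙-comm)
  open import Algebra.Properties.Semiring.Mult.TCOptimised semiring using (×-homo-+; 1+×) renaming (_×_ to _×′_)
  open import Relation.Binary.Reasoning.Setoid setoid

  fromℤ : ℤ → Carrier
  fromℤ (+ n)      = n ×′ 1#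
  fromℤ -[1+ n ]   = - (suc n ×′ 1#)

  [1+x]-[1+y]≈x-y : ∀ x y → (1# + x) - (1# + y) ≈ x - y
  [1+x]-[1+y]≈x-y x y = begin
    (1# + x) - (1# + y)     ≈⟨ +-congˡ (sym (⁻¹-∙-comm 1# y)) ⟩
    (1# + x) + (- 1# - y)   ≈⟨ +-assoc 1# x _ ⟩
    1# + (x + (- 1# - y))   ≈⟨ +-congˡ (trans (sym (+-assoc x _ _)) (trans (+-congʳ (+-comm x _)) (+-assoc _ x _))) ⟩
    1# + (- 1# + (x - y))   ≈⟨ sym (+-assoc 1# _ _) ⟩
    (1# - 1#) + (x - y)     ≈⟨ +-congʳ (-‿inverseʳ 1#) ⟩
    0# + (x - y)            ≈⟨ +-identityˡ _ ⟩
    x - y                   ∎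

  fromℤ-⊖ : ∀ m n → fromℤ (m ⊖ n) ≈ m ×′ 1# - n ×′ 1#
  fromℤ-⊖ zero    zero    = sym (-‿inverseʳ 0#)
  fromℤ-⊖ (suc m) zero    = sym (trans (+-congˡ -0#≈0#) (+-identityʳ _))
  fromℤ-⊖ zero    (suc n) = sym (+-identityˡ _)
  fromℤ-⊖ (suc m) (suc n) = begin
    fromℤ (suc m ⊖ suc n)     ≡⟨ ≡.cong fromℤ (ℤ.[1+m]⊖[1+n]≡m⊖n m n) ⟩
    fromℤ (m ⊖ n)             ≈⟨ fromℤ-⊖ m n ⟩
    m ×′ 1# - n ×′ 1#           ≈⟨ sym ([1+x]-[1+y]≈x-y _ _) ⟩
    (1# + m ×′ 1#) - (1# + n ×′ 1#) ≈⟨ sym (+-cong (1+× m 1#) (-‿cong (1+× n 1#))) ⟩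
    suc m ×′ 1# - suc n ×′ 1#   ∎

  fromℤ-+ : ∀ i j → fromℤ (i ℤ.+ j) ≈ fromℤ i + fromℤ j
  fromℤ-+ (+ m)    (+ n)    = ×-homo-+ 1# m n
  fromℤ-+ (+ m)    -[1+ n ] = fromℤ-⊖ m (suc n)
  fromℤ-+ -[1+ m ] (+ n)    = trans (fromℤ-⊖ n (suc m)) (+-comm _ _)
  fromℤ-+ -[1+ m ] -[1+ n ] = begin
    - (suc (suc (m +ℕ n)) ×′ 1#) ≡⟨ ≡.cong (λ k → - (k ×′ 1#)) (≡.sym (ℕ.+-suc (suc m) n)) ⟩
    - ((suc m +ℕ suc n) ×′ 1#)   ≈⟨ -‿cong (×-homo-+ 1# (suc m) (suc n)) ⟩
    - (suc m ×′ 1# + suc n ×′ 1#)         ≈⟨ sym (⁻¹-∙-comm _ _) ⟩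
    fromℤ -[1+ m ] + fromℤ -[1+ n ]     ∎

  fromℤ-neg : ∀ i → fromℤ (ℤ.- i) ≈ - fromℤ i
  fromℤ-neg (+ zero)  = sym -0#≈0#
  fromℤ-neg (+ suc n) = refl
  fromℤ-neg -[1+ n ]  = sym (-‿involutive _)

  fromℤ-+* : ∀ m j → fromℤ (+ m ℤ.* j) ≈ fromℤ (+ m) * fromℤ j
  fromℤ-+* zero    j = sym (zeroˡ _)
  fromℤ-+* (suc m) j = begin
    fromℤ (+ suc m ℤ.* j)                   ≡⟨ ≡.cong fromℤ (ℤ.suc-* (+ m) j) ⟩
    fromℤ (j ℤ.+ + m ℤ.* j)                 ≈⟨ trans (fromℤ-+ j _) (+-congˡ (fromℤ-+* m j)) ⟩
    fromℤ j + fromℤ (+ m) * fromℤ j         ≈⟨ +-congʳ (sym (*-identityˡ _)) ⟩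
    1# * fromℤ j + fromℤ (+ m) * fromℤ j    ≈⟨ sym (distribʳ _ _ _) ⟩
    (1# + m ×′ 1#) * fromℤ j                 ≈⟨ *-congʳ (sym (1+× m 1#)) ⟩
    fromℤ (+ suc m) * fromℤ j               ∎

  fromℤ-* : ∀ i j → fromℤ (i ℤ.* j) ≈ fromℤ i * fromℤ j
  fromℤ-* (+ m)    j = fromℤ-+* m j
  fromℤ-* -[1+ m ] j = begin
    fromℤ (-[1+ m ] ℤ.* j)                  ≡⟨ ≡.cong fromℤ (≡.sym (ℤ.neg-distribˡ-* (+ suc m) j)) ⟩
    fromℤ (ℤ.- (+ suc m ℤ.* j))             ≈⟨ trans (fromℤ-neg (+ suc m ℤ.* j)) (-‿cong (fromℤ-+* (suc m) j)) ⟩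
    - (fromℤ (+ suc m) * fromℤ j)           ≈⟨ -‿distribˡ-* _ _ ⟩
    fromℤ -[1+ m ] * fromℤ j                ∎

  fromℤ-morphism : ℤ.+-*-rawRing ACR.-Raw-AlmostCommutative⟶ ACR.fromCommutativeRing R
  fromℤ-morphism = record
    { ⟦_⟧ = fromℤ ; +-homo = fromℤ-+ ; *-homo = fromℤ-* ; -‿homo = fromℤ-neg
    ; 0-homo = refl ; 1-homo = refl }

  fromℤ-≟ : ∀ i j → Maybe.Maybe (fromℤ i ≈ fromℤ j)
  fromℤ-≟ i j = Maybe.map (λ { ≡.refl → refl }) (dec⇒weaklyDec ℤ._≟_ i j)

  open import Algebra.Solver.Ring ℤ.+-*-rawRing (ACR.fromCommutativeRing R) fromℤ-morphism fromℤ-≟ public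
    using (solve; _:=_; con; _:+_; _:*_; :-_; _:-_)

module _ {a ℓ : Level} (S : Setoid a ℓ) where
  open Setoid S using (_≈_; sym)
  open import Data.List.Relation.Unary.Unique.Setoid S using (Unique)
  open import Data.List.Relation.Binary.Subset.Setoid S using (_⊆_)

  Unique-lookup-injective : ∀ {xs} → Unique xs → ∀ {i j} → lookup xs i ≈ lookup xs j → i ≡ j
  Unique-lookup-injective (_ ∷ _) {Fin.zero} {Fin.zero} _ = ≡.refl
  Unique-lookup-injective {_ ∷ xs} (x∉xs ∷ _) {Fin.zero} {Fin.suc j} x≈xsⱼ =
    ⊥-elim (All¬⇒¬Any x∉xs (∈-resp-≈ S (sym x≈xsⱼ) (∈-lookup S xs j)))
  Unique-lookup-injective {_ ∷ xs} (x∉xs ∷ _) {Fin.suc i} {Fin.zero} xsᵢ≈x =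
    ⊥-elim (All¬⇒¬Any x∉xs (∈-resp-≈ S xsᵢ≈x (∈-lookup S xs i)))
  Unique-lookup-injective (_ ∷ xs!) {Fin.suc i} {Fin.suc j} eq = ≡.cong Fin.suc (Unique-lookup-injective xs! eq)

  Unique-⊆⇒length≤ : ∀ {xs ys} → Unique xs → xs ⊆ ys → length xs ≤ length ys
  Unique-⊆⇒length≤ {xs} xs! xs⊆ys = injective⇒≤ λ {i} {j} eq →
    Unique-lookup-injective xs! (index-injective S (xs⊆ys (∈-lookup S xs i)) (xs⊆ys (∈-lookup S xs j)) eq)

module FieldArithmetic {c ℓ : Level} (F : FiniteOddField c ℓ) where
  open FiniteOddField F
  open IntegerCoefficients commRing using (solve; _:=_; con; _:+_; _:*_; _:-_)
  open import Algebra.Properties.Group +-group using (x∙y⁻¹≈ε⇒x≈y; inverseˡ-unique)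
  open import Relation.Binary.Reasoning.Setoid setoid

  x*y≈0⇒x≈0⊎y≈0 : ∀ {x y} → x * y ≈ 0# → x ≈ 0# ⊎ y ≈ 0#
  x*y≈0⇒x≈0⊎y≈0 {x} {y} xy≈0 with x ≟ 0#
  ... | yes x≈0 = inj₁ x≈0
  ... | no  x≉0 with inverse x x≉0
  ...   | u , xu≈1 = inj₂ (begin
    y             ≈⟨ sym (*-identityˡ y) ⟩
    1# * y        ≈⟨ *-congʳ (sym xu≈1) ⟩
    (x * u) * y   ≈⟨ solve 3 (λ x u y → (x :* u) :* y := u :* (x :* y)) refl x u y ⟩
    u * (x * y)   ≈⟨ *-congˡ xy≈0 ⟩
    u * 0#        ≈⟨ zeroʳ u ⟩
    0#            ∎)

  x≉0∧x*y≈0⇒y≈0 : ∀ {x y} → ¬ x ≈ 0# → x * y ≈ 0# → y ≈ 0#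
  x≉0∧x*y≈0⇒y≈0 x≉0 xy≈0 with x*y≈0⇒x≈0⊎y≈0 xy≈0
  ... | inj₁ x≈0 = contradiction x≈0 x≉0
  ... | inj₂ y≈0 = y≈0

  *-≉0 : ∀ {x y} → ¬ x ≈ 0# → ¬ y ≈ 0# → ¬ x * y ≈ 0#
  *-≉0 x≉0 y≉0 xy≈0 with x*y≈0⇒x≈0⊎y≈0 xy≈0
  ... | inj₁ x≈0 = x≉0 x≈0
  ... | inj₂ y≈0 = y≉0 y≈0

  *-cancelˡ : ∀ {x y z} → ¬ x ≈ 0# → x * y ≈ x * z → y ≈ z
  *-cancelˡ {x} {y} {z} x≉0 xy≈xz with x*y≈0⇒x≈0⊎y≈0 (begin
    x * (y - z)     ≈⟨ solve 3 (λ x y z → x :* (y :- z) := x :* y :- x :* z) refl x y z ⟩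
    x * y - x * z   ≈⟨ +-congʳ xy≈xz ⟩
    x * z - x * z   ≈⟨ -‿inverseʳ _ ⟩
    0#              ∎)
  ... | inj₁ x≈0   = contradiction x≈0 x≉0
  ... | inj₂ y-z≈0 = x∙y⁻¹≈ε⇒x≈y y z y-z≈0

  x*x≈0⇒x≈0 : ∀ {x} → x * x ≈ 0# → x ≈ 0#
  x*x≈0⇒x≈0 xx≈0 with x*y≈0⇒x≈0⊎y≈0 xx≈0
  ... | inj₁ x≈0 = x≈0
  ... | inj₂ x≈0 = x≈0

  x*x≈y*y⇒x≈±y : ∀ {x y} → x * x ≈ y * y → x ≈ y ⊎ x ≈ - y
  x*x≈y*y⇒x≈±y {x} {y} xx≈yy with x*y≈0⇒x≈0⊎y≈0 (begin
    (x - y) * (x + y)   ≈⟨ solve 2 (λ x y → (x :- y) :* (x :+ y) := x :* x :- y :* y) refl x y ⟩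
    x * x - y * y       ≈⟨ +-congʳ xx≈yy ⟩
    y * y - y * y       ≈⟨ -‿inverseʳ _ ⟩
    0#                  ∎)
  ... | inj₁ x-y≈0 = inj₁ (x∙y⁻¹≈ε⇒x≈y x y x-y≈0)
  ... | inj₂ x+y≈0 = inj₂ (inverseˡ-unique x y x+y≈0)

  x≈-x⇒x≈0 : ∀ {x} → x ≈ - x → x ≈ 0#
  x≈-x⇒x≈0 {x} x≈-x with x*y≈0⇒x≈0⊎y≈0 (begin
    (1# + 1#) * x   ≈⟨ solve 1 (λ x → con (+ 2) :* x := x :+ x) refl x ⟩
    x + x           ≈⟨ +-congˡ x≈-x ⟩
    x - x           ≈⟨ -‿inverseʳ x ⟩
    0#              ∎)
  ... | inj₁ 2≈0 = contradiction 2≈0 odd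
  ... | inj₂ x≈0 = x≈0

  IsSquare : Carrier → Set (c ⊔ ℓ)
  IsSquare a = ∃ λ b → b * b ≈ a

  NonSquare : Carrier → Set (c ⊔ ℓ)
  NonSquare a = ¬ IsSquare a

  NonSquare⇒≉0 : ∀ {a} → NonSquare a → ¬ a ≈ 0#
  NonSquare⇒≉0 ¬□a a≈0 = ¬□a (0# , trans (zeroˡ 0#) (sym a≈0))

  IsSquare-* : ∀ {a b} → IsSquare a → IsSquare b → IsSquare (a * b)
  IsSquare-* (u , uu≈a) (v , vv≈b) =
    u * v , trans (solve 2 (λ u v → (u :* v) :* (u :* v) := (u :* u) :* (v :* v)) refl u v) (*-cong uu≈a vv≈b)

  *-square⇒IsSquare : ∀ {a u v} → ¬ v ≈ 0# → a * (v * v) ≈ u * u → IsSquare a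
  *-square⇒IsSquare {a} {u} {v} v≉0 avv≈uu with inverse v v≉0
  ... | t , vt≈1 = u * t , (begin
    (u * t) * (u * t)               ≈⟨ solve 2 (λ u t → (u :* t) :* (u :* t) := (u :* u) :* (t :* t)) refl u t ⟩
    (u * u) * (t * t)               ≈⟨ *-congʳ (sym avv≈uu) ⟩
    (a * (v * v)) * (t * t)         ≈⟨ solve 3 (λ a v t → (a :* (v :* v)) :* (t :* t) := a :* ((v :* t) :* (v :* t)))
                                               refl a v t ⟩
    a * ((v * t) * (v * t))         ≈⟨ *-congˡ (*-cong vt≈1 vt≈1) ⟩
    a * (1# * 1#)                   ≈⟨ *-congˡ (*-identityˡ 1#) ⟩
    a * 1#                          ≈⟨ *-identityʳ a ⟩
    a                               ∎)

  IsSquare-cancelʳ : ∀ {a b} → ¬ b ≈ 0# → IsSquare b → IsSquare (a * b) → IsSquare a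
  IsSquare-cancelʳ b≉0 (v , vv≈b) (u , uu≈ab) =
    *-square⇒IsSquare (λ v≈0 → b≉0 (trans (sym vv≈b) (trans (*-congʳ v≈0) (zeroˡ v))))
                      (trans (*-congˡ vv≈b) (sym uu≈ab))

  IsSquare-cancelˡ : ∀ {a b} → ¬ a ≈ 0# → IsSquare a → IsSquare (a * b) → IsSquare b
  IsSquare-cancelˡ a≉0 □a (u , uu≈ab) = IsSquare-cancelʳ a≉0 □a (u , trans uu≈ab (*-comm _ _))

module FiniteFieldSquares {c ℓ : Level} (F : FiniteOddField c ℓ) where
  open FiniteOddField F
  open FieldArithmetic F
  open IntegerCoefficients commRing using (solve; _:=_; _:*_)
  open import Data.List.Membership.Setoid setoid using (_∈_; find)
  open import Data.List.Relation.Unary.Unique.Setoid setoid using (Unique)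
  open import Data.List.Relation.Binary.Subset.Setoid setoid using (_⊆_)

  ≈-decSetoid : DecSetoid c ℓ
  ≈-decSetoid = record { isDecEquivalence = record { isEquivalence = isEquivalence ; _≟_ = _≟_ } }

  open import Data.List.Membership.DecSetoid ≈-decSetoid using (_∈?_)

  square : Carrier → Carrier
  square x = x * x

  sameSquare-decSetoid : DecSetoid c ℓ
  sameSquare-decSetoid = On.decSetoid ≈-decSetoid square

  ≉0-resp : ∀ {x y} → x ≈ y → ¬ x ≈ 0# → ¬ y ≈ 0#
  ≉0-resp x≈y x≉0 y≈0 = x≉0 (trans x≈y y≈0)

  elements : List Carrier
  elements = tabulate (proj₁ (proj₂ finite))

  nonzeros : List Carrier
  nonzeros = deduplicate _≟_ (filter (λ x → ¬? (x ≟ 0#)) elements)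

  nonzeros-unique : Unique nonzeros
  nonzeros-unique = deduplicate-! ≈-decSetoid _

  ∈-nonzeros : ∀ {x} → ¬ x ≈ 0# → x ∈ nonzeros
  ∈-nonzeros {x} x≉0 with proj₂ (proj₂ finite) x
  ... | i , eᵢ≈x = ∈-deduplicate⁺ setoid _≟_ (λ y≈z x≈y → trans x≈y (sym y≈z))
    (∈-filter⁺ setoid (λ x → ¬? (x ≟ 0#)) ≉0-resp (tabulate⁺ i (sym eᵢ≈x)) x≉0)

  roots : List Carrier
  roots = deduplicate (DecSetoid._≟_ sameSquare-decSetoid) nonzeros

  roots-≉0 : All (λ x → ¬ x ≈ 0#) roots
  roots-≉0 = deduplicate⁺ _ (deduplicate⁺ _ (all-filter (λ x → ¬? (x ≟ 0#)) elements))

  nonzeros⊆±roots : nonzeros ⊆ roots ++ map -_ roots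
  nonzeros⊆±roots {x} x∈nonzeros with find (∈-deduplicate⁺ (DecSetoid.setoid sameSquare-decSetoid) _
      (λ y≈z x≈y → trans x≈y (sym y≈z)) (Any.map (λ x≈y → *-cong x≈y x≈y) x∈nonzeros))
  ... | r , r∈roots , xx≈rr with x*x≈y*y⇒x≈±y xx≈rr
  ...   | inj₁ x≈r  = ∈-++⁺ˡ setoid (∈-resp-≈ setoid (sym x≈r) r∈roots)
  ...   | inj₂ x≈-r = ∈-++⁺ʳ setoid roots (∈-resp-≈ setoid (sym x≈-r) (∈-map⁺ setoid setoid -‿cong r∈roots))

  squares : List Carrier
  squares = map square roots

  squares-unique : Unique squares
  squares-unique = Unique.map⁺ (DecSetoid.setoid sameSquare-decSetoid) setoid (λ rr≈ss → rr≈ss)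
                     (deduplicate-! sameSquare-decSetoid nonzeros)

  ∈-squares⁻ : ∀ {v} → v ∈ squares → ∃ λ r → ¬ r ≈ 0# × v ≈ r * r
  ∈-squares⁻ v∈squares with ∈-map⁻ setoid setoid v∈squares
  ... | r , r∈roots , v≈rr = r , lookupₛ setoid (λ r≈s → ≉0-resp r≈s) roots-≉0 r∈roots , v≈rr

  module _ {a : Carrier} (¬□a : NonSquare a) where

    squares∪a·squares : List Carrier
    squares∪a·squares = squares ++ map (a *_) squares

    ∈-a·squares⁻ : ∀ {v} → v ∈ map (a *_) squares → ∃ λ r → ¬ r ≈ 0# × v ≈ a * (r * r)
    ∈-a·squares⁻ v∈a·squares with ∈-map⁻ setoid setoid v∈a·squares
    ... | s , s∈squares , v≈as with ∈-squares⁻ s∈squares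
    ...   | r , r≉0 , s≈rr = r , r≉0 , trans v≈as (*-congˡ s≈rr)

    squares∪a·squares-unique : Unique squares∪a·squares
    squares∪a·squares-unique = Unique.++⁺ setoid squares-unique
      (Unique.map⁺ setoid setoid (*-cancelˡ (NonSquare⇒≉0 ¬□a)) squares-unique)
      λ (v∈squares , v∈a·squares) → disjoint (∈-squares⁻ v∈squares) (∈-a·squares⁻ v∈a·squares)
      where
      disjoint : ∀ {v} → (∃ λ r → ¬ r ≈ 0# × v ≈ r * r) → (∃ λ s → ¬ s ≈ 0# × v ≈ a * (s * s)) → ⊥
      disjoint (r , _ , v≈rr) (s , s≉0 , v≈ass) = ¬□a (*-square⇒IsSquare s≉0 (trans (sym v≈ass) v≈rr))

    squares∪a·squares⊆nonzeros : squares∪a·squares ⊆ nonzeros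
    squares∪a·squares⊆nonzeros v∈ with ∈-++⁻ setoid squares v∈
    ... | inj₁ v∈squares with ∈-squares⁻ v∈squares
    ...   | r , r≉0 , v≈rr = ∈-nonzeros (≉0-resp (sym v≈rr) (*-≉0 r≉0 r≉0))
    squares∪a·squares⊆nonzeros v∈ | inj₂ v∈a·squares with ∈-a·squares⁻ v∈a·squares
    ...   | r , r≉0 , v≈arr = ∈-nonzeros (≉0-resp (sym v≈arr) (*-≉0 (NonSquare⇒≉0 ¬□a) (*-≉0 r≉0 r≉0)))

    nonzeros-length≤ : length nonzeros ≤ length squares∪a·squares
    nonzeros-length≤ = ℕ.≤-trans (Unique-⊆⇒length≤ setoid nonzeros-unique nonzeros⊆±roots) (ℕ.≤-reflexive (begin
      length (roots ++ map -_ roots)                  ≡⟨ length-++ roots ⟩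
      length roots +ℕ length (map -_ roots)           ≡⟨ ≡.cong (length roots +ℕ_) (length-map -_ roots) ⟩
      length roots +ℕ length roots                    ≡⟨ ≡.cong₂ _+ℕ_ (length-map square roots)
                                                           (≡.trans (length-map (a *_) squares) (length-map square roots)) ⟨
      length squares +ℕ length (map (a *_) squares)   ≡⟨ length-++ squares ⟨
      length squares∪a·squares                        ∎))
      where open ≡.≡-Reasoning

    NonSquare-* : ∀ {b} → NonSquare b → IsSquare (a * b)
    NonSquare-* {b} ¬□b with b ∈? squares∪a·squares
    ... | yes b∈ = Sum.[ (λ b∈squares → contradiction (IsSquare-of (∈-squares⁻ b∈squares)) ¬□b)
                       , (IsSquare-a* ∘ ∈-a·squares⁻) ] (∈-++⁻ setoid squares b∈)
      where
      IsSquare-of : (∃ λ r → ¬ r ≈ 0# × b ≈ r * r) → IsSquare b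
      IsSquare-of (r , _ , b≈rr) = r , sym b≈rr
      IsSquare-a* : (∃ λ r → ¬ r ≈ 0# × b ≈ a * (r * r)) → IsSquare (a * b)
      IsSquare-a* (r , _ , b≈arr) = a * r , (begin
        (a * r) * (a * r)    ≈⟨ solve 2 (λ a r → (a :* r) :* (a :* r) := a :* (a :* (r :* r))) refl a r ⟩
        a * (a * (r * r))    ≈⟨ *-congˡ (sym b≈arr) ⟩
        a * b                ∎)
        where open import Relation.Binary.Reasoning.Setoid setoid
    ... | no b∉ = ⊥-elim (ℕ.<-irrefl ≡.refl (ℕ.≤-trans
          (Unique-⊆⇒length≤ setoid (¬Any⇒All¬ _ b∉ ∷ squares∪a·squares-unique) b∷⊆nonzeros) nonzeros-length≤))
      where
      b∷⊆nonzeros : (b ∷ squares∪a·squares) ⊆ nonzeros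
      b∷⊆nonzeros (here v≈b) = ∈-resp-≈ setoid (sym v≈b) (∈-nonzeros (NonSquare⇒≉0 ¬□b))
      b∷⊆nonzeros (there v∈) = squares∪a·squares⊆nonzeros v∈

module Geometry {ℓ₁ ℓ₂ : Level} (F : FiniteOddField ℓ₁ ℓ₂) (w : FiniteOddField.Carrier F) where
  open FiniteOddField F
  open FieldArithmetic F
  open PG3 F w hiding (IsSquare; NonSquare)
  open IntegerCoefficients commRing using (solve; _:=_; con; _:+_; _:*_; :-_; _:-_)
  open import Algebra.Properties.Ring (CommutativeRing.ring commRing) using (-0#≈0#; -‿distribʳ-*)
  open import Algebra.Properties.Group +-group using (x∙y⁻¹≈ε⇒x≈y; inverseˡ-unique; ⁻¹-injective)
  open import Relation.Binary.Reasoning.Setoid setoid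

  ≋-refl : ∀ {X} → X ≋ X
  ≋-refl = refl , refl , refl , refl

  ≋-sym : ∀ {X Y} → X ≋ Y → Y ≋ X
  ≋-sym (e₁ , e₂ , e₃ , e₄) = sym e₁ , sym e₂ , sym e₃ , sym e₄

  ≋-trans : ∀ {X Y Z} → X ≋ Y → Y ≋ Z → X ≋ Z
  ≋-trans (e₁ , e₂ , e₃ , e₄) (f₁ , f₂ , f₃ , f₄) = trans e₁ f₁ , trans e₂ f₂ , trans e₃ f₃ , trans e₄ f₄

  InSpan : V4 → V4 → V4 → Set (ℓ₁ ⊔ ℓ₂)
  InSpan U W X = ∃₂ λ a b → X ≋ ((a · U) ⊕ (b · W))

  ·⊕·-cong : ∀ {a a′ b b′} U W → a ≈ a′ → b ≈ b′ → ((a · U) ⊕ (b · W)) ≋ ((a′ · U) ⊕ (b′ · W))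
  ·⊕·-cong {a} {a′} {b} {b′} U W a≈a′ b≈b′ = lin , lin , lin , lin
    where
    lin : ∀ {u v} → a * u + b * v ≈ a′ * u + b′ * v
    lin = +-cong (*-congʳ a≈a′) (*-congʳ b≈b′)

  1·⊕0· : ∀ U W → ((1# · U) ⊕ (0# · W)) ≋ U
  1·⊕0· U W = unit (x₁ U) (x₁ W) , unit (x₂ U) (x₂ W) , unit (x₃ U) (x₃ W) , unit (x₄ U) (x₄ W)
    where
    unit : ∀ u w → 1# * u + 0# * w ≈ u
    unit u w = solve 2 (λ u w → con (+ 1) :* u :+ con (+ 0) :* w := u) refl u w

  0·⊕1· : ∀ U W → ((0# · U) ⊕ (1# · W)) ≋ W
  0·⊕1· U W = unit (x₁ U) (x₁ W) , unit (x₂ U) (x₂ W) , unit (x₃ U) (x₃ W) , unit (x₄ U) (x₄ W)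
    where
    unit : ∀ u w → 0# * u + 1# * w ≈ w
    unit u w = solve 2 (λ u w → con (+ 0) :* u :+ con (+ 1) :* w := w) refl u w

  0·⊕0· : ∀ U W → ((0# · U) ⊕ (0# · W)) ≋ 𝟎
  0·⊕0· U W = null (x₁ U) (x₁ W) , null (x₂ U) (x₂ W) , null (x₃ U) (x₃ W) , null (x₄ U) (x₄ W)
    where
    null : ∀ u w → 0# * u + 0# * w ≈ 0#
    null u w = solve 2 (λ u w → con (+ 0) :* u :+ con (+ 0) :* w := con (+ 0)) refl u w

  ·⊕·-substitute : ∀ {a b a₁ b₁ a₂ b₂ X Y U W} →
    X ≋ ((a₁ · U) ⊕ (b₁ · W)) → Y ≋ ((a₂ · U) ⊕ (b₂ · W)) →
    ((a · X) ⊕ (b · Y)) ≋ (((a * a₁ + b * a₂) · U) ⊕ ((a * b₁ + b * b₂) · W))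
  ·⊕·-substitute {a} {b} {a₁} {b₁} {a₂} {b₂} (e₁ , e₂ , e₃ , e₄) (f₁ , f₂ , f₃ , f₄) =
    subst e₁ f₁ , subst e₂ f₂ , subst e₃ f₃ , subst e₄ f₄
    where
    subst : ∀ {x y u v} → x ≈ a₁ * u + b₁ * v → y ≈ a₂ * u + b₂ * v →
            a * x + b * y ≈ (a * a₁ + b * a₂) * u + (a * b₁ + b * b₂) * v
    subst {x} {y} {u} {v} x≈ y≈ = trans (+-cong (*-congˡ x≈) (*-congˡ y≈))
      (solve 8 (λ a b a₁ b₁ a₂ b₂ u v → a :* (a₁ :* u :+ b₁ :* v) :+ b :* (a₂ :* u :+ b₂ :* v)
                                 := (a :* a₁ :+ b :* a₂) :* u :+ (a :* b₁ :+ b :* b₂) :* v)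
             refl a b a₁ b₁ a₂ b₂ u v)

  ·⊕·-substitute≈ : ∀ {a b a₁ b₁ a₂ b₂ s t X Y U W} →
    X ≋ ((a₁ · U) ⊕ (b₁ · W)) → Y ≋ ((a₂ · U) ⊕ (b₂ · W)) →
    a * a₁ + b * a₂ ≈ s → a * b₁ + b * b₂ ≈ t → ((a · X) ⊕ (b · Y)) ≋ ((s · U) ⊕ (t · W))
  ·⊕·-substitute≈ {U = U} {W} X≈ Y≈ s≈ t≈ = ≋-trans (·⊕·-substitute X≈ Y≈) (·⊕·-cong U W s≈ t≈)

  ·-·⊕· : ∀ t a b U W → (t · ((a · U) ⊕ (b · W))) ≋ (((t * a) · U) ⊕ ((t * b) · W))
  ·-·⊕· t a b U W = scale (x₁ U) (x₁ W) , scale (x₂ U) (x₂ W) , scale (x₃ U) (x₃ W) , scale (x₄ U) (x₄ W)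
    where
    scale : ∀ u v → t * (a * u + b * v) ≈ (t * a) * u + (t * b) * v
    scale u v = solve 5 (λ t a b u v → t :* (a :* u :+ b :* v) := (t :* a) :* u :+ (t :* b) :* v) refl t a b u v

  ·⊕0· : ∀ a U W → ((a · U) ⊕ (0# · W)) ≋ (a · U)
  ·⊕0· a U W = drop (x₁ U) (x₁ W) , drop (x₂ U) (x₂ W) , drop (x₃ U) (x₃ W) , drop (x₄ U) (x₄ W)
    where
    drop : ∀ u v → a * u + 0# * v ≈ a * u
    drop u v = solve 3 (λ a u v → a :* u :+ con (+ 0) :* v := a :* u) refl a u v

  Independent⇒·⊕·-injective : ∀ {U W a b a′ b′} → Independent U W →
    ((a · U) ⊕ (b · W)) ≋ ((a′ · U) ⊕ (b′ · W)) → a ≈ a′ × b ≈ b′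
  Independent⇒·⊕·-injective {U} {W} {a} {b} {a′} {b′} indep (e₁ , e₂ , e₃ , e₄) =
    x∙y⁻¹≈ε⇒x≈y a a′ (proj₁ differences≈0) , x∙y⁻¹≈ε⇒x≈y b b′ (proj₂ differences≈0)
    where
    difference : ∀ {u v} → a * u + b * v ≈ a′ * u + b′ * v → (a - a′) * u + (b - b′) * v ≈ 0#
    difference {u} {v} e = begin
      (a - a′) * u + (b - b′) * v             ≈⟨ solve 6 (λ a b a′ b′ u v → (a :- a′) :* u :+ (b :- b′) :* v
                                                   := (a :* u :+ b :* v) :- (a′ :* u :+ b′ :* v)) refl a b a′ b′ u v ⟩
      (a * u + b * v) - (a′ * u + b′ * v)     ≈⟨ +-congʳ e ⟩
      (a′ * u + b′ * v) - (a′ * u + b′ * v)   ≈⟨ -‿inverseʳ _ ⟩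
      0#                                      ∎

    differences≈0 : a - a′ ≈ 0# × b - b′ ≈ 0#
    differences≈0 = indep (a - a′) (b - b′) (difference e₁ , difference e₂ , difference e₃ , difference e₄)

  ·⊕·-rescale : ∀ {a b c σ σ′} U W → σ * σ′ ≈ 1# → b * σ ≈ a * c →
    ((a * σ′) · ((σ · U) ⊕ (c · W))) ≋ ((a · U) ⊕ (b · W))
  ·⊕·-rescale {a} {b} {c} {σ} {σ′} U W σσ′≈1 bσ≈ac = ≋-trans (·-·⊕· (a * σ′) σ c U W) (·⊕·-cong U W
    (begin
      (a * σ′) * σ   ≈⟨ solve 3 (λ a σ σ′ → (a :* σ′) :* σ := a :* (σ :* σ′)) refl a σ σ′ ⟩
      a * (σ * σ′)   ≈⟨ *-congˡ σσ′≈1 ⟩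
      a * 1#         ≈⟨ *-identityʳ a ⟩
      a              ∎)
    (begin
      (a * σ′) * c   ≈⟨ solve 3 (λ a σ′ c → (a :* σ′) :* c := (a :* c) :* σ′) refl a σ′ c ⟩
      (a * c) * σ′   ≈⟨ *-congʳ (sym bσ≈ac) ⟩
      (b * σ) * σ′   ≈⟨ solve 3 (λ b σ σ′ → (b :* σ) :* σ′ := b :* (σ :* σ′)) refl b σ σ′ ⟩
      b * (σ * σ′)   ≈⟨ *-congˡ σσ′≈1 ⟩
      b * 1#         ≈⟨ *-identityʳ b ⟩
      b              ∎))

  InSpan-trans : ∀ {U W X Y Z} → InSpan U W X → InSpan U W Y → InSpan X Y Z → InSpan U W Z
  InSpan-trans (_ , _ , X≈) (_ , _ , Y≈) (_ , _ , Z≈) = _ , _ , ≋-trans Z≈ (·⊕·-substitute X≈ Y≈)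

  OnLine-mono : ∀ {U W A B X} → InSpan U W A → InSpan U W B → OnLine A B X → OnLine U W X
  OnLine-mono A∈ B∈ = map₂ (InSpan-trans A∈ B∈)

  basis-change : ∀ {R P A B} → Independent R P → InSpan A B R → InSpan A B P → InSpan R P A × InSpan R P B
  basis-change {R} {P} {A} {B} indep (rA , rB , R≈) (pA , pB , P≈) =
    (u * pB , - (u * rB) , ≋-sym (≋-trans (·⊕·-substitute≈ R≈ P≈ (trans A-coeff₁ Du≈1) A-coeff₂) (1·⊕0· A B))) ,
    (- (u * pA) , u * rA , ≋-sym (≋-trans (·⊕·-substitute≈ R≈ P≈ B-coeff₁ (trans B-coeff₂ Du≈1)) (0·⊕1· A B)))
    where
    D : Carrier
    D = rA * pB - rB * pA

    D≉0 : ¬ D ≈ 0#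
    D≉0 D≈0 = 1≉0 (proj₁ (indep 1# 0# (≋-trans (1·⊕0· R P)
                   (≋-trans R≈ (≋-trans (·⊕·-cong A B rA≈0 rB≈0) (0·⊕0· A B))))))
      where
      rB≈0 : rB ≈ 0#
      rB≈0 = proj₂ (indep (- pB) rB (≋-trans (·⊕·-substitute≈ R≈ P≈
        (trans (solve 4 (λ rA rB pA pB → (:- pB) :* rA :+ rB :* pA := :- (rA :* pB :- rB :* pA)) refl rA rB pA pB)
               (trans (-‿cong D≈0) -0#≈0#))
        (solve 2 (λ rB pB → (:- pB) :* rB :+ rB :* pB := con (+ 0)) refl rB pB)) (0·⊕0· A B)))
      rA≈0 : rA ≈ 0#
      rA≈0 = proj₂ (indep (- pA) rA (≋-trans (·⊕·-substitute≈ R≈ P≈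
        (solve 2 (λ rA pA → (:- pA) :* rA :+ rA :* pA := con (+ 0)) refl rA pA)
        (trans (solve 4 (λ rA rB pA pB → (:- pA) :* rB :+ rA :* pB := rA :* pB :- rB :* pA) refl rA rB pA pB) D≈0))
        (0·⊕0· A B)))

    u : Carrier
    u = proj₁ (inverse D D≉0)

    Du≈1 : D * u ≈ 1#
    Du≈1 = proj₂ (inverse D D≉0)

    A-coeff₁ : (u * pB) * rA + - (u * rB) * pA ≈ D * u
    A-coeff₁ = solve 5 (λ rA rB pA pB u → (u :* pB) :* rA :+ :- (u :* rB) :* pA := (rA :* pB :- rB :* pA) :* u)
                 refl rA rB pA pB u

    A-coeff₂ : (u * pB) * rB + - (u * rB) * pB ≈ 0#
    A-coeff₂ = solve 3 (λ rB pB u → (u :* pB) :* rB :+ :- (u :* rB) :* pB := con (+ 0)) refl rB pB u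

    B-coeff₁ : - (u * pA) * rA + (u * rA) * pA ≈ 0#
    B-coeff₁ = solve 3 (λ rA pA u → :- (u :* pA) :* rA :+ (u :* rA) :* pA := con (+ 0)) refl rA pA u

    B-coeff₂ : - (u * pA) * rB + (u * rA) * pB ≈ D * u
    B-coeff₂ = solve 5 (λ rA rB pA pB u → :- (u :* pA) :* rB :+ (u :* rA) :* pB := (rA :* pB :- rB :* pA) :* u)
                 refl rA rB pA pB u

  Polar : V4 → V4 → Carrier
  Polar X Y = ((1# + 1#) * (x₁ X * x₁ Y) - (1# + 1#) * (w * (x₂ X * x₂ Y))) + (x₃ X * x₄ Y + x₄ X * x₃ Y)

  Q-·⊕· : ∀ a b X Y → Q ((a · X) ⊕ (b · Y)) ≈ ((a * a) * Q X + (a * b) * Polar X Y) + (b * b) * Q Y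
  Q-·⊕· a b X Y = solve 11 (λ w a b x₁ x₂ x₃ x₄ y₁ y₂ y₃ y₄ →
      ((a :* x₁ :+ b :* y₁) :* (a :* x₁ :+ b :* y₁) :- w :* ((a :* x₂ :+ b :* y₂) :* (a :* x₂ :+ b :* y₂)))
        :+ (a :* x₃ :+ b :* y₃) :* (a :* x₄ :+ b :* y₄)
      := ((a :* a) :* ((x₁ :* x₁ :- w :* (x₂ :* x₂)) :+ x₃ :* x₄)
          :+ (a :* b) :* ((con (+ 2) :* (x₁ :* y₁) :- con (+ 2) :* (w :* (x₂ :* y₂))) :+ (x₃ :* y₄ :+ x₄ :* y₃)))
         :+ (b :* b) :* ((y₁ :* y₁ :- w :* (y₂ :* y₂)) :+ y₃ :* y₄))
    refl w a b (x₁ X) (x₂ X) (x₃ X) (x₄ X) (x₁ Y) (x₂ Y) (x₃ Y) (x₄ Y)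

  Q-cong : ∀ {X Y} → X ≋ Y → Q X ≈ Q Y
  Q-cong (e₁ , e₂ , e₃ , e₄) = +-cong (+-cong (*-cong e₁ e₁) (-‿cong (*-congˡ (*-cong e₂ e₂)))) (*-cong e₃ e₄)

  Qλ≈Q+lx₄² : ∀ l X → Qλ l X ≈ Q X + l * (x₄ X * x₄ X)
  Qλ≈Q+lx₄² l X = solve 6 (λ w l x₁ x₂ x₃ x₄ →
      ((x₁ :* x₁ :- w :* (x₂ :* x₂)) :+ l :* (x₄ :* x₄)) :+ x₃ :* x₄
      := ((x₁ :* x₁ :- w :* (x₂ :* x₂)) :+ x₃ :* x₄) :+ l :* (x₄ :* x₄))
    refl w l (x₁ X) (x₂ X) (x₃ X) (x₄ X)

  norm-anisotropic : NonSquare w → ∀ {x y} → x * x - w * (y * y) ≈ 0# → x ≈ 0# × y ≈ 0#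
  norm-anisotropic ¬□w {x} {y} N≈0 with y ≟ 0#
  ... | no y≉0 = contradiction (*-square⇒IsSquare y≉0 wyy≈xx) ¬□w
    where
    wyy≈xx : w * (y * y) ≈ x * x
    wyy≈xx = sym (x∙y⁻¹≈ε⇒x≈y _ _ N≈0)
  ... | yes y≈0 = x*x≈0⇒x≈0 (begin
    x * x                ≈⟨ x∙y⁻¹≈ε⇒x≈y _ _ N≈0 ⟩
    w * (y * y)          ≈⟨ *-congˡ (*-congʳ y≈0) ⟩
    w * (0# * y)         ≈⟨ solve 2 (λ w y → w :* (con (+ 0) :* y) := con (+ 0)) refl w y ⟩
    0#                   ∎) , y≈0

  𝓔λ∖U₃⇒x₄≉0 : NonSquare w → ∀ {l R} → NonZero R → Qλ l R ≈ 0# → ¬ SamePoint R U₃ → ¬ x₄ R ≈ 0#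
  𝓔λ∖U₃⇒x₄≉0 ¬□w {l} {R} R≉𝟎 QλR≈0 R≠U₃ r₄≈0 =
    R≠U₃ (x₃ R , r₃≉0 , (trans r₁≈0 (sym (zeroʳ _)) , trans r₂≈0 (sym (zeroʳ _)) ,
                         sym (*-identityʳ _) , trans r₄≈0 (sym (zeroʳ _))))
    where
    r₁≈0×r₂≈0 : x₁ R ≈ 0# × x₂ R ≈ 0#
    r₁≈0×r₂≈0 = norm-anisotropic ¬□w (begin
      x₁ R * x₁ R - w * (x₂ R * x₂ R)                            ≈⟨ sym (+-identityʳ _) ⟩
      (x₁ R * x₁ R - w * (x₂ R * x₂ R)) + 0#                     ≈⟨ +-congˡ (sym (trans (*-congʳ r₄≈0) (zeroˡ _))) ⟩
      (x₁ R * x₁ R - w * (x₂ R * x₂ R)) + x₄ R * (l * x₄ R + x₃ R) ≈⟨ solve 6 (λ w l x₁ x₂ x₃ x₄ →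
          (x₁ :* x₁ :- w :* (x₂ :* x₂)) :+ x₄ :* (l :* x₄ :+ x₃)
          := ((x₁ :* x₁ :- w :* (x₂ :* x₂)) :+ l :* (x₄ :* x₄)) :+ x₃ :* x₄) refl w l (x₁ R) (x₂ R) (x₃ R) (x₄ R) ⟩
      Qλ l R                                                     ≈⟨ QλR≈0 ⟩
      0#                                                         ∎)

    r₁≈0 : x₁ R ≈ 0#
    r₁≈0 = proj₁ r₁≈0×r₂≈0

    r₂≈0 : x₂ R ≈ 0#
    r₂≈0 = proj₂ r₁≈0×r₂≈0

    r₃≉0 : ¬ x₃ R ≈ 0#
    r₃≉0 r₃≈0 = R≉𝟎 (r₁≈0 , r₂≈0 , r₃≈0 , r₄≈0)

  x₄≉0∧x₄≈0⇒Independent : ∀ {R P} → ¬ x₄ R ≈ 0# → NonZero P → x₄ P ≈ 0# → Independent R P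
  x₄≉0∧x₄≈0⇒Independent {R} {P} r₄≉0 P≉𝟎 p₄≈0 a b (e₁ , e₂ , e₃ , e₄) = a≈0 , b≈0
    where
    a≈0 : a ≈ 0#
    a≈0 = x≉0∧x*y≈0⇒y≈0 r₄≉0 (trans (*-comm _ a)
            (trans (sym (trans (+-congˡ (trans (*-congˡ p₄≈0) (zeroʳ b))) (+-identityʳ _))) e₄))
    b*p≈0 : ∀ {r p} → a * r + b * p ≈ 0# → b * p ≈ 0#
    b*p≈0 {r} {p} e = trans (sym (trans (+-congʳ (trans (*-congʳ a≈0) (zeroˡ r))) (+-identityˡ _))) e
    b≈0 : b ≈ 0#
    b≈0 with b ≟ 0#
    ... | yes b≈0 = b≈0
    ... | no  b≉0 = contradiction (x≉0∧x*y≈0⇒y≈0 b≉0 (b*p≈0 e₁) , x≉0∧x*y≈0⇒y≈0 b≉0 (b*p≈0 e₂) ,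
                                   x≉0∧x*y≈0⇒y≈0 b≉0 (b*p≈0 e₃) , p₄≈0) P≉𝟎

  module TangentLine {l : Carrier} {R P : V4} (l≉0 : ¬ l ≈ 0#) (r₄≉0 : ¬ x₄ R ≈ 0#) (QλR≈0 : Qλ l R ≈ 0#)
                     (independent : Independent R P) (p₄≈0 : x₄ P ≈ 0#) (σ≉0 : ¬ Q P ≈ 0#)
                     (tangent : ∀ X → OnLine R P X → Qλ l X ≈ 0# → SamePoint X R) where

    σ r₄ : Carrier
    σ = Q P
    r₄ = x₄ R

    x₄-·⊕· : ∀ a b → x₄ ((a · R) ⊕ (b · P)) ≈ a * r₄
    x₄-·⊕· a b = trans (+-congˡ (trans (*-congˡ p₄≈0) (zeroʳ b))) (+-identityʳ _)

    OnLine-·⊕· : ∀ {a} b → ¬ a ≈ 0# → OnLine R P ((a · R) ⊕ (b · P))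
    OnLine-·⊕· {a} b a≉0 = (λ X≋𝟎 → *-≉0 a≉0 r₄≉0 (trans (sym (x₄-·⊕· a b)) (proj₂ (proj₂ (proj₂ X≋𝟎))))) ,
                           a , b , ≋-refl

    QR≈-lr₄² : Q R ≈ - (l * (r₄ * r₄))
    QR≈-lr₄² = inverseˡ-unique _ _ (trans (sym (Qλ≈Q+lx₄² l R)) QλR≈0)

    -- Otherwise the second intersection σR − Polar(R,P)P of the line with 𝓔_λ would differ from R.
    polar≈0 : Polar R P ≈ 0#
    polar≈0 = SamePoint-X-R⇒β≈0 (tangent X (OnLine-·⊕· (- β) σ≉0) QλX≈0)
      where
      β : Carrier
      β = Polar R P

      X : V4
      X = (σ · R) ⊕ ((- β) · P)

      QλX≈0 : Qλ l X ≈ 0#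
      QλX≈0 = begin
        Qλ l X
          ≈⟨ Qλ≈Q+lx₄² l X ⟩
        Q X + l * (x₄ X * x₄ X)
          ≈⟨ +-cong (Q-·⊕· σ (- β) R P) (*-congˡ (*-cong (x₄-·⊕· σ (- β)) (x₄-·⊕· σ (- β)))) ⟩
        ((σ * σ) * Q R + (σ * - β) * β) + (- β * - β) * σ + l * ((σ * r₄) * (σ * r₄))
          ≈⟨ +-congʳ (+-congʳ (+-congʳ (*-congˡ QR≈-lr₄²))) ⟩
        ((σ * σ) * - (l * (r₄ * r₄)) + (σ * - β) * β) + (- β * - β) * σ + l * ((σ * r₄) * (σ * r₄))
          ≈⟨ solve 4 (λ σ β l r₄ → ((σ :* σ) :* :- (l :* (r₄ :* r₄)) :+ (σ :* :- β) :* β) :+ (:- β :* :- β) :* σ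
                                     :+ l :* ((σ :* r₄) :* (σ :* r₄)) := con (+ 0)) refl σ β l r₄ ⟩
        0#
          ∎

      SamePoint-X-R⇒β≈0 : SamePoint X R → β ≈ 0#
      SamePoint-X-R⇒β≈0 (k , _ , X≋kR) = ⁻¹-injective (trans (proj₂ (Independent⇒·⊕·-injective independent
        (≋-trans X≋kR (≋-sym (·⊕0· k R P))))) (sym -0#≈0#))

    Q-on-line : ∀ a b → Q ((a · R) ⊕ (b · P)) ≈ (b * b) * σ - (a * a) * (l * (r₄ * r₄))
    Q-on-line a b = begin
      Q ((a · R) ⊕ (b · P))
        ≈⟨ Q-·⊕· a b R P ⟩
      ((a * a) * Q R + (a * b) * Polar R P) + (b * b) * σ
        ≈⟨ +-congʳ (+-cong (*-congˡ QR≈-lr₄²) (*-congˡ polar≈0)) ⟩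
      ((a * a) * - (l * (r₄ * r₄)) + (a * b) * 0#) + (b * b) * σ
        ≈⟨ solve 5 (λ a b σ l r₄ → ((a :* a) :* :- (l :* (r₄ :* r₄)) :+ (a :* b) :* con (+ 0)) :+ (b :* b) :* σ
                                   := (b :* b) :* σ :- (a :* a) :* (l :* (r₄ :* r₄))) refl a b σ l r₄ ⟩
      (b * b) * σ - (a * a) * (l * (r₄ * r₄))
        ∎

    isotropic : ∀ {Z} → OnLine R P Z → Q Z ≈ 0# →
      ∃₂ λ a b → Z ≋ ((a · R) ⊕ (b · P)) × ¬ a ≈ 0# × (b * σ) * (b * σ) ≈ ((a * r₄) * (a * r₄)) * (l * σ)
    isotropic {Z} (Z≉𝟎 , a , b , Z≋) QZ≈0 = a , b , Z≋ , a≉0 , (begin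
      (b * σ) * (b * σ)                      ≈⟨ solve 2 (λ b σ → (b :* σ) :* (b :* σ) := σ :* ((b :* b) :* σ))
                                                   refl b σ ⟩
      σ * ((b * b) * σ)                      ≈⟨ *-congˡ bbσ≈aalr₄² ⟩
      σ * ((a * a) * (l * (r₄ * r₄)))        ≈⟨ solve 4 (λ σ a l r₄ → σ :* ((a :* a) :* (l :* (r₄ :* r₄)))
                                                   := ((a :* r₄) :* (a :* r₄)) :* (l :* σ)) refl σ a l r₄ ⟩
      ((a * r₄) * (a * r₄)) * (l * σ)        ∎)
      where
      bbσ≈aalr₄² : (b * b) * σ ≈ (a * a) * (l * (r₄ * r₄))
      bbσ≈aalr₄² = x∙y⁻¹≈ε⇒x≈y _ _ (trans (sym (Q-on-line a b)) (trans (sym (Q-cong Z≋)) QZ≈0))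
      a≉0 : ¬ a ≈ 0#
      a≉0 a≈0 = Z≉𝟎 (≋-trans Z≋ (≋-trans (·⊕·-cong R P a≈0 b≈0) (0·⊕0· R P)))
        where
        b≈0 : b ≈ 0#
        b≈0 = x*x≈0⇒x≈0 (x≉0∧x*y≈0⇒y≈0 σ≉0 (begin
          σ * (b * b)                   ≈⟨ *-comm σ _ ⟩
          (b * b) * σ                   ≈⟨ bbσ≈aalr₄² ⟩
          (a * a) * (l * (r₄ * r₄))     ≈⟨ *-congʳ (*-congʳ a≈0) ⟩
          (0# * a) * (l * (r₄ * r₄))    ≈⟨ solve 3 (λ a l r₄ → (con (+ 0) :* a) :* (l :* (r₄ :* r₄)) := con (+ 0))
                                              refl a l r₄ ⟩
          0#                            ∎))

    meets-none : NonSquare (l * σ) → MeetsE0 R P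
    meets-none ¬□lσ Z onZ QZ≈0 =
      let a , b , _ , a≉0 , bσ²≈ = isotropic onZ QZ≈0
      in ¬□lσ (*-square⇒IsSquare (*-≉0 a≉0 r₄≉0) (trans (*-comm _ _) (sym bσ²≈)))

    σ′ : Carrier
    σ′ = proj₁ (inverse σ σ≉0)

    σσ′≈1 : σ * σ′ ≈ 1#
    σσ′≈1 = proj₂ (inverse σ σ≉0)

    σ′≉0 : ¬ σ′ ≈ 0#
    σ′≉0 σ′≈0 = 1≉0 (trans (sym σσ′≈1) (trans (*-congˡ σ′≈0) (zeroʳ σ)))

    module TwoPoints {k : Carrier} (kk≈lσ : k * k ≈ l * σ) where

      c : Carrier
      c = k * r₄

      X : Carrier → V4
      X c′ = (σ · R) ⊕ (c′ · P)

      c≉0 : ¬ c ≈ 0#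
      c≉0 = *-≉0 (λ k≈0 → *-≉0 l≉0 σ≉0 (trans (sym kk≈lσ) (trans (*-congʳ k≈0) (zeroˡ k)))) r₄≉0

      X∈𝓔 : ∀ c′ → c′ * c′ ≈ c * c → Q (X c′) ≈ 0#
      X∈𝓔 c′ c′²≈c² = begin
        Q (X c′)                                              ≈⟨ Q-on-line σ c′ ⟩
        (c′ * c′) * σ - (σ * σ) * (l * (r₄ * r₄))             ≈⟨ +-congʳ (*-congʳ (trans c′²≈c² (trans
            (solve 2 (λ k r₄ → (k :* r₄) :* (k :* r₄) := (k :* k) :* (r₄ :* r₄)) refl k r₄) (*-congʳ kk≈lσ)))) ⟩
        ((l * σ) * (r₄ * r₄)) * σ - (σ * σ) * (l * (r₄ * r₄)) ≈⟨ solve 3 (λ l σ r₄ →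
            ((l :* σ) :* (r₄ :* r₄)) :* σ :- (σ :* σ) :* (l :* (r₄ :* r₄)) := con (+ 0)) refl l σ r₄ ⟩
        0#                                                    ∎

      X₊≠X₋ : ¬ SamePoint (X c) (X (- c))
      X₊≠X₋ (t , _ , X≋tX) = c≉0 (x≈-x⇒x≈0 (trans c≈t·-c (trans (*-congʳ t≈1) (*-identityˡ _))))
        where
        σ≈tσ×c≈t·-c : σ ≈ t * σ × c ≈ t * - c
        σ≈tσ×c≈t·-c = Independent⇒·⊕·-injective independent (≋-trans X≋tX (·-·⊕· t σ (- c) R P))
        σ≈tσ : σ ≈ t * σ
        σ≈tσ = proj₁ σ≈tσ×c≈t·-c
        c≈t·-c : c ≈ t * - c
        c≈t·-c = proj₂ σ≈tσ×c≈t·-c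
        t≈1 : t ≈ 1#
        t≈1 = sym (*-cancelˡ σ≉0 (trans (*-identityʳ σ) (trans σ≈tσ (*-comm t σ))))

      SamePoint-X : ∀ {Z a b} c′ → Z ≋ ((a · R) ⊕ (b · P)) → ¬ a ≈ 0# → b * σ ≈ a * c′ → SamePoint Z (X c′)
      SamePoint-X c′ Z≋ a≉0 bσ≈ac′ = _ , *-≉0 a≉0 σ′≉0 , ≋-trans Z≋ (≋-sym (·⊕·-rescale R P σσ′≈1 bσ≈ac′))

      a²r₄²lσ≈a²c² : ∀ a → ((a * r₄) * (a * r₄)) * (l * σ) ≈ (a * c) * (a * c)
      a²r₄²lσ≈a²c² a = begin
        ((a * r₄) * (a * r₄)) * (l * σ)   ≈⟨ *-congˡ (sym kk≈lσ) ⟩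
        ((a * r₄) * (a * r₄)) * (k * k)   ≈⟨ solve 3 (λ a r₄ k → ((a :* r₄) :* (a :* r₄)) :* (k :* k)
                                                := (a :* (k :* r₄)) :* (a :* (k :* r₄))) refl a r₄ k ⟩
        (a * c) * (a * c)                 ∎

      X±-exhaust : ∀ Z → OnLine R P Z → Q Z ≈ 0# → SamePoint Z (X c) ⊎ SamePoint Z (X (- c))
      X±-exhaust Z onZ QZ≈0 =
        let a , b , Z≋ , a≉0 , bσ²≈ = isotropic onZ QZ≈0
        in Sum.map (SamePoint-X c Z≋ a≉0) (λ bσ≈-ac → SamePoint-X (- c) Z≋ a≉0 (trans bσ≈-ac (-‿distribʳ-* a c)))
                   (x*x≈y*y⇒x≈±y (trans bσ²≈ (a²r₄²lσ≈a²c² a)))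

    meets-two : IsSquare (l * σ) → MeetsE2 R P
    meets-two (k , kk≈lσ) = X c , X (- c) , OnLine-·⊕· c σ≉0 , X∈𝓔 c refl , OnLine-·⊕· (- c) σ≉0 ,
                            X∈𝓔 (- c) (solve 1 (λ c → :- c :* :- c := c :* c) refl c) , X₊≠X₋ , X±-exhaust
      where open TwoPoints kk≈lσ

  MeetsE0-transfer : ∀ {A B U W} → (∀ {X} → OnLine A B X → OnLine U W X) → MeetsE0 U W → MeetsE0 A B
  MeetsE0-transfer AB⊆UW meets X onX = meets X (AB⊆UW onX)

  MeetsE2-transfer : ∀ {A B U W} → (∀ {X} → OnLine A B X → OnLine U W X) → (∀ {X} → OnLine U W X → OnLine A B X) →
    MeetsE2 U W → MeetsE2 A B
  MeetsE2-transfer AB⊆UW UW⊆AB (X , Y , onX , QX≈0 , onY , QY≈0 , X≠Y , every) =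
    X , Y , UW⊆AB onX , QX≈0 , UW⊆AB onY , QY≈0 , X≠Y , λ Z onZ → every Z (AB⊆UW onZ)

  tangent-line-meets-𝓔 : NonSquare w → ∀ {l R A B P} → ¬ l ≈ 0# →
    NonZero R → Qλ l R ≈ 0# → ¬ SamePoint R U₃ → OnLine A B R → (∀ X → OnLine A B X → Qλ l X ≈ 0# → SamePoint X R) →
    OnLine A B P → Inπ P → ¬ Q P ≈ 0# →
    (NonSquare (l * Q P) → MeetsE0 A B) × (IsSquare (l * Q P) → MeetsE2 A B)
  tangent-line-meets-𝓔 ¬□w {l} {R} {A} {B} {P} l≉0 R≉𝟎 QλR≈0 R≠U₃ onR tangent onP (P≉𝟎 , p₄≈0) σ≉0 =
    MeetsE0-transfer AB⊆RP ∘ meets-none , MeetsE2-transfer AB⊆RP RP⊆AB ∘ meets-two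
    where
    r₄≉0 : ¬ x₄ R ≈ 0#
    r₄≉0 = 𝓔λ∖U₃⇒x₄≉0 ¬□w R≉𝟎 QλR≈0 R≠U₃

    independent : Independent R P
    independent = x₄≉0∧x₄≈0⇒Independent r₄≉0 P≉𝟎 p₄≈0

    RP⊆AB : ∀ {X} → OnLine R P X → OnLine A B X
    RP⊆AB = OnLine-mono (proj₂ onR) (proj₂ onP)

    AB⊆RP : ∀ {X} → OnLine A B X → OnLine R P X
    AB⊆RP = uncurry OnLine-mono (basis-change independent (proj₂ onR) (proj₂ onP))

    open TangentLine l≉0 r₄≉0 QλR≈0 independent p₄≈0 σ≉0 (λ X onX → tangent X (RP⊆AB onX))

lemma3p5 : {c ℓ : Level} (F : FiniteOddField c ℓ) →
    let open FiniteOddField F in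
    (w : Carrier) → ¬ (PG3.IsSquare F w w) →
    let open PG3 F w in
    (l : Carrier) → ¬ (l ≈ 0#) →
    (R : V4) → NonZero R → Qλ l R ≈ 0# → ¬ SamePoint R U₃ →
    (A B : V4) → Independent A B →
    OnLine A B R → (∀ X → OnLine A B X → Qλ l X ≈ 0# → SamePoint X R) →
    (P : V4) → OnLine A B P → Inπ P →
    (Inπ₀ P → (NonSquare l → MeetsE0 A B) × (IsSquare l → MeetsE2 A B)) ×
    (Inπ₁ P → (NonSquare l → MeetsE2 A B) × (IsSquare l → MeetsE0 A B))
lemma3p5 F w ¬□w l l≉0 R R≉𝟎 QλR≈0 R≠U₃ A B _ onR tangent P onP inπ =
  (λ { (_ , σ≉0 , □σ) →
         (λ ¬□l → proj₁ (meets σ≉0) (¬□l ∘ IsSquare-cancelʳ σ≉0 □σ)) ,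
         (λ □l → proj₂ (meets σ≉0) (IsSquare-* □l □σ)) }) ,
  (λ { (_ , ¬□σ) →
         (λ ¬□l → proj₂ (meets (NonSquare⇒≉0 ¬□σ)) (NonSquare-* ¬□l ¬□σ)) ,
         (λ □l → proj₁ (meets (NonSquare⇒≉0 ¬□σ)) (¬□σ ∘ IsSquare-cancelˡ l≉0 □l)) })
  where
  open FiniteOddField F using (_≈_; 0#; _*_)
  open FieldArithmetic F
  open FiniteFieldSquares F using (NonSquare-*)
  open PG3 F w using (Q; MeetsE0; MeetsE2)

  meets : ¬ Q P ≈ 0# → (NonSquare (l * Q P) → MeetsE0 A B) × (IsSquare (l * Q P) → MeetsE2 A B)
  meets = Geometry.tangent-line-meets-𝓔 F w ¬□w l≉0 R≉𝟎 QλR≈0 R≠U₃ onR tangent onP inπ
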